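{- Let $G$ be a finite abelian group of order $n\ge 2$, let $t$ be an integer with $2\le t\le n-1$, and let $m$ be a positive integer with $$n>\sigma(G,t)\cdot\binom{2m-2+t}{t}.$$ Then $G$ has a $t$-independent set of size $m$.
   Context: $G$ is written additively. For a positive integer $h$, $\mathrm{Tor}(G,h)=\{x\in G: hx=0\}$, and $\sigma(G,t)=\sum_{h=1}^t|\mathrm{Tor}(G,h)|$. A subset $A=\{a_1,\dots,a_m\}$ of $G$ is called $t$-independent if whenever $\lambda_1a_1+\cdots+\lambda_ma_m=0$ for integers $\lambda_i$ with $\sum|\lambda_i|\le t$, we have all $\lambda_i=0$. -}

module Defs where

open import Level using (Level; _⊔_)
open import Data.Nat using (ℕ; zero; suc; _+_)
open import Data.Fin using (Fin; zero; suc)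
open import Data.Integer using (ℤ; +_; -[1+_]; ∣_∣)
open import Data.Product using (Σ; _,_)
open import Relation.Binary.PropositionalEquality using (_≡_)
open import Relation.Nullary using (Dec; yes; no)
open import Algebra.Bundles using (AbelianGroup)
import Algebra.Definitions.RawMonoid as RM

record FiniteAbelianGroup (c ℓ : Level) (n : ℕ) : Set (Level.suc (c ⊔ ℓ)) where
  field
    abGroup : AbelianGroup c ℓ
  open AbelianGroup abGroup public
  field
    _≈?_       : (x y : Carrier) → Dec (x ≈ y)
    enum       : Fin n → Carrier
    enum-inj   : ∀ i j → enum i ≈ enum j → i ≡ j
    enum-surj  : ∀ x → Σ (Fin n) (λ i → enum i ≈ x)

∑ℕ : ∀ {k} → (Fin k → ℕ) → ℕ
∑ℕ {zero}  f = 0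
∑ℕ {suc k} f = f zero + ∑ℕ (λ i → f (suc i))

count : ∀ {k} {p} {P : Fin k → Set p} → ((i : Fin k) → Dec (P i)) → ℕ
count {zero}  d = 0
count {suc k} d with d zero
... | yes _ = suc (count (λ i → d (suc i)))
... | no  _ = count (λ i → d (suc i))

module _ {c ℓ : Level} {n : ℕ} (G : FiniteAbelianGroup c ℓ n) where
  open FiniteAbelianGroup G
  open RM rawMonoid using (sum) renaming (_×_ to _⊗_)

  _·ℕ_ : ℕ → Carrier → Carrier
  h ·ℕ x = h ⊗ x

  _·ℤ_ : ℤ → Carrier → Carrier
  (+ k)      ·ℤ x = k ⊗ x
  (-[1+ k ]) ·ℤ x = (suc k ⊗ x) ⁻¹

  torCard : ℕ → ℕ
  torCard h = count (λ i → (h ·ℕ enum i) ≈? ε)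

  σ : ℕ → ℕ
  σ zero    = 0
  σ (suc t) = σ t + torCard (suc t)

  -- a : Fin m → G lists m distinct elements (modulo ≈), i.e. a set of size m
  Distinct : ∀ {m} → (Fin m → Carrier) → Set ℓ
  Distinct a = ∀ i j → a i ≈ a j → i ≡ j

  Independent : ℕ → ∀ {m} → (Fin m → Carrier) → Set ℓ
  Independent t {m} a =
    (λs : Fin m → ℤ) → ∑ℕ (λ i → ∣ λs i ∣) Data.Nat.≤ t →
    sum (λ i → λs i ·ℤ a i) ≈ ε → ∀ i → λs i ≡ + 0

{-# OPTIONS --safe #-}
-- Build the set greedily.  Suppose a₁ … a_k (k < m) is t-independent.  Adjoining x breaks
-- t-independence only if h·x = μ₁a₁ + ⋯ + μ_k a_k for some 1 ≤ h ≤ t and some μ with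
-- Σ|μᵢ| ≤ t − h.  Writing μᵢ = μᵢ⁺ − μᵢ⁻, such μ are indexed by vectors of ℕ^{2k} with sum
-- at most t − h, of which there are C(2k + t − h, t − h) ≤ C(2m − 2 + t, t); and for a fixed
-- right-hand side the solutions x form a coset of Tor(G,h).  So at most σ(G,t)·C(2m − 2 + t, t)
-- < n elements are excluded and some x is admissible.  Finally, a 2-independent set has no
-- repeated element, since aᵢ − aⱼ = 0 is a relation of weight 2.
module Submission where

open import Defs
open import Level using (Level; Lift; lift; _⊔_)
open import Function using (_∘_)
open import Data.Nat using (ℕ; zero; suc; _≤_; _<_; _∸_; _+_; _*_; z≤n; s≤s; _≤′_; ≤′-refl; ≤′-step)
open import Data.Nat.Properties
open import Data.Nat.Combinatorics using (_C_; nCn≡1; nCk+nC[k+1]≡[n+1]C[k+1])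
open import Data.Integer as ℤ using (ℤ; +_; -[1+_]; ∣_∣)
open import Data.Integer.Properties using (∣-i∣≡∣i∣)
open import Data.Fin using (Fin; zero; suc)
open import Data.Fin.Properties using (injective⇒≤; any?) renaming (suc-injective to Fin-suc-injective)
open import Data.Vec.Functional using (head; tail) renaming (_∷_ to _◃_)
open import Data.Product using (Σ; ∃; _×_; _,_; proj₁; proj₂)
open import Data.Sum using (_⊎_; inj₁; inj₂)
open import Data.Empty using (⊥; ⊥-elim)
open import Data.List using (List; []; _∷_; [_]; length; map; _++_)
open import Data.List.Properties using (length-map; length-++)
open import Data.List.Relation.Unary.Any as Any using (here)
import Data.List.Membership.Setoid as Membership
import Data.List.Membership.Setoid.Properties as Membershipₚ
open import Relation.Nullary using (Dec; yes; no; ¬_; contradiction)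
open import Relation.Nullary.Decidable using (_⊎-dec_)
open import Relation.Binary.PropositionalEquality
  using (_≡_; refl; sym; trans; cong; cong₂; subst; module ≡-Reasoning)
import Algebra.Definitions.RawMonoid as RawMonoidDefinitions
import Algebra.Properties.AbelianGroup as AbelianGroupProperties
import Algebra.Properties.CommutativeMonoid.Mult as MultProperties
import Relation.Binary.Reasoning.Setoid as SetoidReasoning

private
  variable
    p q r : Level
    k : ℕ

module _ {P : Fin (suc k) → Set p} (P? : ∀ i → Dec (P i)) where

  count-yes : P zero → count P? ≡ suc (count (P? ∘ suc))
  count-yes p with P? zero
  ... | yes _ = refl
  ... | no ¬p = contradiction p ¬p

  count-tail≤ : count (P? ∘ suc) ≤ count P?
  count-tail≤ with P? zero
  ... | yes _ = n≤1+n _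
  ... | no _ = ≤-refl

none⇒count≡0 : {P : Fin k → Set p} (P? : ∀ i → Dec (P i)) → (∀ i → ¬ P i) → count P? ≡ 0
none⇒count≡0 {k = zero} P? none = refl
none⇒count≡0 {k = suc k} P? none with P? zero
... | yes p = contradiction p (none zero)
... | no _ = none⇒count≡0 (P? ∘ suc) (none ∘ suc)

count-⊎ : {R : Fin k → Set r} {P : Fin k → Set p} {Q : Fin k → Set q}
  (R? : ∀ i → Dec (R i)) (P? : ∀ i → Dec (P i)) (Q? : ∀ i → Dec (Q i)) →
  (∀ i → R i → P i ⊎ Q i) → count R? ≤ count P? + count Q?
count-⊎ {k = zero} R? P? Q? R⇒P⊎Q = z≤n
count-⊎ {k = suc k} R? P? Q? R⇒P⊎Q with R? zero | count-⊎ (R? ∘ suc) (P? ∘ suc) (Q? ∘ suc) (R⇒P⊎Q ∘ suc)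
... | no _ | bound = ≤-trans bound (+-mono-≤ (count-tail≤ P?) (count-tail≤ Q?))
... | yes r | bound with R⇒P⊎Q zero r
...   | inj₁ p rewrite count-yes P? p = s≤s (≤-trans bound (+-monoʳ-≤ _ (count-tail≤ Q?)))
...   | inj₂ q rewrite count-yes Q? q | +-suc (count P?) (count (Q? ∘ suc)) =
  s≤s (≤-trans bound (+-monoˡ-≤ _ (count-tail≤ P?)))

count<⇒∃¬ : {P : Fin k → Set p} (P? : ∀ i → Dec (P i)) → count P? < k → ∃ λ i → ¬ P i
count<⇒∃¬ {k = suc k} P? count<k with P? zero
... | no ¬p = zero , ¬p
... | yes _ = let i , ¬p = count<⇒∃¬ (P? ∘ suc) (≤-pred count<k) in suc i , ¬p

select : {P : Fin k → Set p} (P? : ∀ i → Dec (P i)) → Fin (count P?) → Fin k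
select {k = suc k} P? i with P? zero
select {k = suc k} P? zero | yes _ = zero
select {k = suc k} P? (suc i) | yes _ = suc (select (P? ∘ suc) i)
select {k = suc k} P? i | no _ = suc (select (P? ∘ suc) i)

select-satisfies : {P : Fin k → Set p} (P? : ∀ i → Dec (P i)) (i : Fin (count P?)) → P (select P? i)
select-satisfies {k = suc k} P? i with P? zero
select-satisfies {k = suc k} P? zero | yes p = p
select-satisfies {k = suc k} P? (suc i) | yes _ = select-satisfies (P? ∘ suc) i
select-satisfies {k = suc k} P? i | no _ = select-satisfies (P? ∘ suc) i

select-injective : {P : Fin k → Set p} (P? : ∀ i → Dec (P i)) {i j : Fin (count P?)} → select P? i ≡ select P? j → i ≡ j
select-injective {k = suc k} P? {i} {j} eq with P? zero
select-injective {k = suc k} P? {zero} {zero} eq | yes _ = refl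
select-injective {k = suc k} P? {suc i} {suc j} eq | yes _ = cong suc (select-injective (P? ∘ suc) (Fin-suc-injective eq))
select-injective {k = suc k} P? {i} {j} eq | no _ = select-injective (P? ∘ suc) (Fin-suc-injective eq)

rank : {P : Fin k → Set p} (P? : ∀ i → Dec (P i)) (i : Fin k) → P i → Fin (count P?)
rank {k = suc k} P? i p with P? zero
rank {k = suc k} P? zero p | yes _ = zero
rank {k = suc k} P? (suc i) p | yes _ = suc (rank (P? ∘ suc) i p)
rank {k = suc k} P? zero p | no ¬p = contradiction p ¬p
rank {k = suc k} P? (suc i) p | no _ = rank (P? ∘ suc) i p

select-rank : {P : Fin k → Set p} (P? : ∀ i → Dec (P i)) (i : Fin k) (p : P i) → select P? (rank P? i p) ≡ i
select-rank {k = suc k} P? i p with P? zero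
select-rank {k = suc k} P? zero p | yes _ = refl
select-rank {k = suc k} P? (suc i) p | yes _ = cong suc (select-rank (P? ∘ suc) i p)
select-rank {k = suc k} P? zero p | no ¬p = contradiction p ¬p
select-rank {k = suc k} P? (suc i) p | no _ = cong suc (select-rank (P? ∘ suc) i p)

count-≤-injection : {P : Fin k → Set p} {Q : Fin k → Set q} (P? : ∀ i → Dec (P i)) (Q? : ∀ i → Dec (Q i))
  (f : Fin k → Fin k) → (∀ {i j} → f i ≡ f j → i ≡ j) → (∀ i → P i → Q (f i)) → count P? ≤ count Q?
count-≤-injection P? Q? f f-injective P⇒Q∘f = injective⇒≤ {f = g} g-injective
  where
  g : Fin (count P?) → Fin (count Q?)
  g i = rank Q? (f (select P? i)) (P⇒Q∘f _ (select-satisfies P? i))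
  g-injective : ∀ {i j} → g i ≡ g j → i ≡ j
  g-injective {i} {j} eq = select-injective P? (f-injective (begin
    f (select P? i)                ≡⟨ select-rank Q? _ _ ⟨
    select Q? (g i)               ≡⟨ cong (select Q?) eq ⟩
    select Q? (g j)               ≡⟨ select-rank Q? _ _ ⟩
    f (select P? j)                ∎))
    where open ≡-Reasoning

count-any≤ : {A : Set q} {R : Fin k → A → Set r} (R? : ∀ i x → Dec (R i x)) (xs : List A) (N : ℕ) →
  (∀ x → count (λ i → R? i x) ≤ N) → count (λ i → Any.any? (R? i) xs) ≤ length xs * N
count-any≤ R? [] N bound = ≤-reflexive (none⇒count≡0 (λ i → Any.any? (R? i) []) (λ i ()))
count-any≤ R? (x ∷ xs) N bound =
  ≤-trans (count-⊎ (λ i → Any.any? (R? i) (x ∷ xs)) (λ i → R? i x) (λ i → Any.any? (R? i) xs) (λ i → Any.toSum))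
          (+-mono-≤ (bound x) (count-any≤ R? xs N bound))

m+n≤o⇒n≤o∸m : ∀ m {n o} → m + n ≤ o → n ≤ o ∸ m
m+n≤o⇒n≤o∸m m {n} {o} le = m+n≤o⇒m≤o∸n n (subst (_≤ o) (+-comm m n) le)

step-mono⇒mono : (f : ℕ → ℕ) → (∀ n → f n ≤ f (suc n)) → ∀ {m n} → m ≤ n → f m ≤ f n
step-mono⇒mono f step = go ∘ ≤⇒≤′
  where
  go : ∀ {m n} → m ≤′ n → f m ≤ f n
  go ≤′-refl = ≤-refl
  go (≤′-step m≤′n) = ≤-trans (go m≤′n) (step _)

C-monoˡ : ∀ n s → n C s ≤ suc n C s
C-monoˡ n zero = ≤-refl
C-monoˡ n (suc s) = ≤-trans (m≤n+m (n C suc s) (n C s)) (≤-reflexive (nCk+nC[k+1]≡[n+1]C[k+1] n s))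

C-mono-diagonal : ∀ d s → (d + s) C s ≤ (d + suc s) C suc s
C-mono-diagonal d s = begin
  (d + s) C s                       ≤⟨ m≤m+n _ _ ⟩
  (d + s) C s + (d + s) C suc s     ≡⟨ nCk+nC[k+1]≡[n+1]C[k+1] (d + s) s ⟩
  suc (d + s) C suc s               ≡⟨ cong (_C suc s) (+-suc d s) ⟨
  (d + suc s) C suc s               ∎
  where open ≤-Reasoning

C-mono : ∀ {d d′ s s′} → d ≤ d′ → s ≤ s′ → (d + s) C s ≤ (d′ + s′) C s′
C-mono {d} {d′} {s} {s′} d≤d′ s≤s′ = ≤-trans
  (step-mono⇒mono (λ e → (e + s) C s) (λ e → C-monoˡ (e + s) s) d≤d′)
  (step-mono⇒mono (λ u → (d′ + u) C u) (C-mono-diagonal d′) s≤s′)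

-- P h for some 1 ≤ h ≤ j (anyUpTo? of Data.Nat.Properties ranges over h < j instead).
AnyUpTo⁺ : (ℕ → Set p) → ℕ → Set p
AnyUpTo⁺ {p} P zero = Lift p ⊥
AnyUpTo⁺ P (suc j) = AnyUpTo⁺ P j ⊎ P (suc j)

anyUpTo⁺? : {P : ℕ → Set p} → (∀ h → Dec (P h)) → ∀ j → Dec (AnyUpTo⁺ P j)
anyUpTo⁺? P? zero = no λ { (lift ()) }
anyUpTo⁺? P? (suc j) = anyUpTo⁺? P? j ⊎-dec P? (suc j)

anyUpTo⁺-intro : {P : ℕ → Set p} → ∀ h {j} → suc h ≤ j → P (suc h) → AnyUpTo⁺ P j
anyUpTo⁺-intro h {suc j} h<j p with m≤n⇒m<n∨m≡n h<j
... | inj₁ h+1<j+1 = inj₁ (anyUpTo⁺-intro h (≤-pred h+1<j+1) p)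
... | inj₂ refl = inj₂ p

module _ {c ℓ : Level} {n : ℕ} (G : FiniteAbelianGroup c ℓ n) where
  open FiniteAbelianGroup G renaming (refl to ≈-refl; sym to ≈-sym; trans to ≈-trans)
  open RawMonoidDefinitions rawMonoid using (sum) renaming (_×_ to _·_)
  open AbelianGroupProperties abGroup
  open MultProperties commutativeMonoid using (×-congʳ; ×-distrib-+)
  open Membership setoid using (_∈_)
  open Membershipₚ using (∈-resp-≈; ∈-map⁺; ∈-++⁺ˡ; ∈-++⁺ʳ)

  infixr 8 _⊙_
  _⊙_ : ℤ → Carrier → Carrier
  _⊙_ = _·ℤ_ G

  ·-⁻¹ : ∀ j x → j · (x ⁻¹) ≈ (j · x) ⁻¹
  ·-⁻¹ zero x = ≈-sym ε⁻¹≈ε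
  ·-⁻¹ (suc j) x = ≈-trans (∙-congˡ (·-⁻¹ j x)) (⁻¹-∙-comm x (j · x))

  ⊙-neg : ∀ z x → (ℤ.- z) ⊙ x ≈ (z ⊙ x) ⁻¹
  ⊙-neg (+ zero) x = ≈-sym ε⁻¹≈ε
  ⊙-neg (+ suc j) x = ≈-refl
  ⊙-neg -[1+ j ] x = ≈-sym (⁻¹-involutive _)

  combination : (Fin k → ℤ) → (Fin k → Carrier) → Carrier
  combination μ a = sum (λ i → μ i ⊙ a i)

  weight : (Fin k → ℤ) → ℕ
  weight μ = ∑ℕ (λ i → ∣ μ i ∣)

  neg : (Fin k → ℤ) → Fin k → ℤ
  neg μ = ℤ.-_ ∘ μ

  combination-neg : ∀ (μ : Fin k → ℤ) a → combination (neg μ) a ≈ combination μ a ⁻¹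
  combination-neg {zero} μ a = ≈-sym ε⁻¹≈ε
  combination-neg {suc k} μ a =
    ≈-trans (∙-cong (⊙-neg (head μ) (head a)) (combination-neg (tail μ) (tail a))) (⁻¹-∙-comm _ _)

  weight-neg : ∀ (μ : Fin k → ℤ) → weight (neg μ) ≡ weight μ
  weight-neg {zero} μ = refl
  weight-neg {suc k} μ = cong₂ _+_ (∣-i∣≡∣i∣ (head μ)) (weight-neg (tail μ))

  zeros : Fin k → ℤ
  zeros _ = + 0

  combination-zeros : ∀ (a : Fin k → Carrier) → combination zeros a ≈ ε
  combination-zeros {zero} a = ≈-refl
  combination-zeros {suc k} a = ≈-trans (identityˡ _) (combination-zeros (tail a))

  weight-zeros : weight (zeros {k}) ≡ 0
  weight-zeros {zero} = refl
  weight-zeros {suc k} = weight-zeros {k}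

  δ : Fin k → Fin k → ℤ
  δ zero = + 1 ◃ zeros
  δ (suc i) = + 0 ◃ δ i

  combination-δ : ∀ (i : Fin k) a → combination (δ i) a ≈ a i
  combination-δ zero a = ≈-trans (∙-cong (identityʳ _) (combination-zeros (tail a))) (identityʳ _)
  combination-δ (suc i) a = ≈-trans (identityˡ _) (combination-δ i (tail a))

  weight-δ : ∀ (i : Fin k) → weight (δ i) ≡ 1
  weight-δ {suc k} zero = cong suc (weight-zeros {k})
  weight-δ (suc i) = weight-δ i

  -- addMultiples x F s lists j·x ∙ y for all j ≤ s and y ∈ F (s ∸ j).
  addMultiples : Carrier → (ℕ → List Carrier) → ℕ → List Carrier
  addMultiples x F zero = F zero
  addMultiples x F (suc s) = F (suc s) ++ map (x ∙_) (addMultiples x F s)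

  length-addMultiples : ∀ x F d → (∀ s → length (F s) ≡ (d + s) C s) →
    ∀ s → length (addMultiples x F s) ≡ (suc d + s) C s
  length-addMultiples x F d length-F zero = length-F zero
  length-addMultiples x F d length-F (suc s) = begin
    length (F (suc s) ++ map (x ∙_) (addMultiples x F s))
      ≡⟨ length-++ (F (suc s)) ⟩
    length (F (suc s)) + length (map (x ∙_) (addMultiples x F s))
      ≡⟨ cong₂ _+_ (length-F (suc s))
                   (trans (length-map (x ∙_) (addMultiples x F s)) (length-addMultiples x F d length-F s)) ⟩
    (d + suc s) C suc s + (suc d + s) C s
      ≡⟨ cong (λ e → e C suc s + (suc d + s) C s) (+-suc d s) ⟩
    (suc d + s) C suc s + (suc d + s) C s
      ≡⟨ +-comm ((suc d + s) C suc s) ((suc d + s) C s) ⟩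
    (suc d + s) C s + (suc d + s) C suc s
      ≡⟨ nCk+nC[k+1]≡[n+1]C[k+1] (suc d + s) s ⟩
    suc (suc d + s) C suc s
      ≡⟨ cong (_C suc s) (+-suc (suc d) s) ⟨
    (suc d + suc s) C suc s ∎
    where open ≡-Reasoning

  ⊆-addMultiples : ∀ {x F y} s → y ∈ F s → y ∈ addMultiples x F s
  ⊆-addMultiples zero y∈ = y∈
  ⊆-addMultiples (suc s) y∈ = ∈-++⁺ˡ setoid y∈

  ∈-addMultiples : ∀ {x F y} j {s} → j ≤ s → y ∈ F (s ∸ j) → (j · x) ∙ y ∈ addMultiples x F s
  ∈-addMultiples zero {s} _ y∈ = ∈-resp-≈ setoid (≈-sym (identityˡ _)) (⊆-addMultiples s y∈)
  ∈-addMultiples {x} {F} (suc j) {suc s} (s≤s j≤s) y∈ = ∈-++⁺ʳ setoid (F (suc s))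
    (∈-resp-≈ setoid (≈-sym (assoc _ _ _)) (∈-map⁺ setoid setoid ∙-congˡ (∈-addMultiples j j≤s y∈)))

  -- Each coefficient μᵢ = μᵢ⁺ − μᵢ⁻ is produced by two rounds of addMultiples, one for aᵢ and
  -- one for aᵢ⁻¹.
  smallCombinations : (Fin k → Carrier) → ℕ → List Carrier
  smallCombinations {zero} a s = [ ε ]
  smallCombinations {suc k} a s =
    addMultiples (head a) (addMultiples (head a ⁻¹) (smallCombinations (tail a))) s

  length-smallCombinations : ∀ (a : Fin k → Carrier) s → length (smallCombinations a s) ≡ (2 * k + s) C s
  length-smallCombinations {zero} a s = sym (nCn≡1 s)
  length-smallCombinations {suc k} a s = trans
    (length-addMultiples _ _ (suc (2 * k)) (length-addMultiples _ _ (2 * k) (length-smallCombinations (tail a))) s)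
    (cong (λ d → (d + s) C s) (sym (*-suc 2 k)))

  combination-∈ : ∀ (μ : Fin k → ℤ) a {s} → weight μ ≤ s → combination μ a ∈ smallCombinations a s
  combination-∈ {zero} μ a _ = here ≈-refl
  combination-∈ {suc k} μ a {s} = headCase (head μ)
    where
    y : Carrier
    y = combination (tail μ) (tail a)
    y∈ : ∀ j → j + weight (tail μ) ≤ s → y ∈ smallCombinations (tail a) (s ∸ j)
    y∈ j le = combination-∈ (tail μ) (tail a) (m+n≤o⇒n≤o∸m j le)
    headCase : ∀ z → ∣ z ∣ + weight (tail μ) ≤ s → (z ⊙ head a) ∙ y ∈ smallCombinations a s
    headCase (+ j) le = ∈-addMultiples j (m+n≤o⇒m≤o j le) (⊆-addMultiples (s ∸ j) (y∈ j le))
    headCase -[1+ j ] le = ⊆-addMultiples s (∈-resp-≈ setoid (∙-congʳ (·-⁻¹ (suc j) (head a)))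
      (∈-addMultiples (suc j) (m+n≤o⇒m≤o (suc j) le) (y∈ (suc j) le)))

  independent-tail : ∀ {t} {a : Fin (suc k) → Carrier} → Independent G t a → Independent G t (tail a)
  independent-tail ind μ w≤t relation i = ind (+ 0 ◃ μ) w≤t (≈-trans (identityˡ _) relation) (suc i)

  independent⇒distinct : ∀ {t} {a : Fin k → Carrier} → 2 ≤ t → Independent G t a → Distinct G a
  independent⇒distinct 2≤t ind zero zero _ = refl
  independent⇒distinct {t = t} {a} 2≤t ind zero (suc j) a₀≈aⱼ =
    contradiction (ind (+ 1 ◃ neg (δ j)) w≤t relation zero) λ ()
    where
    w≤t : weight (+ 1 ◃ neg (δ j)) ≤ t
    w≤t = subst (λ w → suc w ≤ t) (sym (trans (weight-neg (δ j)) (weight-δ j))) 2≤t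
    relation : combination (+ 1 ◃ neg (δ j)) a ≈ ε
    relation = begin
      (a zero ∙ ε) ∙ combination (neg (δ j)) (tail a)  ≈⟨ ∙-cong (identityʳ _) (combination-neg (δ j) (tail a)) ⟩
      a zero ∙ combination (δ j) (tail a) ⁻¹          ≈⟨ ∙-congˡ (⁻¹-cong (combination-δ j (tail a))) ⟩
      a zero ∙ a (suc j) ⁻¹                           ≈⟨ ∙-congʳ a₀≈aⱼ ⟩
      a (suc j) ∙ a (suc j) ⁻¹                        ≈⟨ inverseʳ _ ⟩
      ε                                               ∎
      where open SetoidReasoning setoid
  independent⇒distinct {a = a} 2≤t ind (suc i) zero aᵢ≈a₀ =
    sym (independent⇒distinct {a = a} 2≤t ind zero (suc i) (≈-sym aᵢ≈a₀))
  independent⇒distinct {a = a} 2≤t ind (suc i) (suc j) aᵢ≈aⱼ =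
    cong suc (independent⇒distinct {a = tail a} 2≤t (independent-tail {a = a} ind) i j aᵢ≈aⱼ)

  Obstruction : (Fin k → Carrier) → ℕ → Carrier → ℕ → Set (c ⊔ ℓ)
  Obstruction a t x h = h · x ∈ smallCombinations a (t ∸ h)

  obstruction? : ∀ (a : Fin k → Carrier) t x h → Dec (Obstruction a t x h)
  obstruction? a t x h = Any.any? ((h · x) ≈?_) (smallCombinations a (t ∸ h))

  module _ {t} {a : Fin k → Carrier} {x} (ind : Independent G t a)
           (unobstructed : ¬ AnyUpTo⁺ (Obstruction a t x) t) where

    private
      obstructed : ∀ h (ν : Fin k → ℤ) → suc h ≤ t → weight ν ≤ t ∸ suc h → suc h · x ≈ combination ν a → ⊥
      obstructed h ν h<t w≤ eq =
        unobstructed (anyUpTo⁺-intro h h<t (∈-resp-≈ setoid (≈-sym eq) (combination-∈ ν a w≤)))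

    head≡0 : ∀ z (ν : Fin k → ℤ) → ∣ z ∣ + weight ν ≤ t → (z ⊙ x) ∙ combination ν a ≈ ε → z ≡ + 0
    head≡0 (+ zero) ν _ _ = refl
    head≡0 (+ suc h) ν w≤t relation = ⊥-elim (obstructed h (neg ν) (m+n≤o⇒m≤o (suc h) w≤t)
      (subst (_≤ t ∸ suc h) (sym (weight-neg ν)) (m+n≤o⇒n≤o∸m (suc h) w≤t))
      (≈-trans (inverseˡ-unique _ _ relation) (≈-sym (combination-neg ν a))))
    head≡0 -[1+ h ] ν w≤t relation = ⊥-elim (obstructed h ν (m+n≤o⇒m≤o (suc h) w≤t)
      (m+n≤o⇒n≤o∸m (suc h) w≤t) (⁻¹-injective (inverseˡ-unique _ _ relation)))

    tail-relation : ∀ {z y} → z ≡ + 0 → (z ⊙ x) ∙ y ≈ ε → y ≈ ε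
    tail-relation refl relation = ≈-trans (≈-sym (identityˡ _)) relation

    independent-extend : Independent G t (x ◃ a)
    independent-extend μ w≤t relation zero = head≡0 (head μ) (tail μ) w≤t relation
    independent-extend μ w≤t relation (suc i) =
      ind (tail μ) (m+n≤o⇒n≤o ∣ head μ ∣ w≤t) (tail-relation (independent-extend μ w≤t relation zero) relation) i

  index : Carrier → Fin n
  index x = proj₁ (enum-surj x)

  enum-index : ∀ x → enum (index x) ≈ x
  enum-index x = proj₂ (enum-surj x)

  -- The solutions of h·x = g form a coset of Tor(G,h), so translating by −x₀ for one solution x₀
  -- injects them into Tor(G,h).
  count-fibre≤torCard : ∀ h g → count (λ i → (h · enum i) ≈? g) ≤ torCard G h
  count-fibre≤torCard h g with any? (λ i → (h · enum i) ≈? g)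
  ... | no none = subst (_≤ torCard G h) (sym (none⇒count≡0 _ (λ i p → none (i , p)))) z≤n
  ... | yes (i₀ , p₀) = count-≤-injection (λ i → (h · enum i) ≈? g) (λ i → (h · enum i) ≈? ε)
      translate translate-injective translate-kernel
    where
    translate : Fin n → Fin n
    translate i = index (enum i ∙ enum i₀ ⁻¹)
    translate-injective : ∀ {i j} → translate i ≡ translate j → i ≡ j
    translate-injective {i} {j} eq = enum-inj i j (∙-cancelʳ (enum i₀ ⁻¹) (enum i) (enum j) (begin
      enum i ∙ enum i₀ ⁻¹    ≈⟨ enum-index _ ⟨
      enum (translate i)     ≡⟨ cong enum eq ⟩
      enum (translate j)     ≈⟨ enum-index _ ⟩
      enum j ∙ enum i₀ ⁻¹    ∎))
      where open SetoidReasoning setoid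
    translate-kernel : ∀ i → h · enum i ≈ g → h · enum (translate i) ≈ ε
    translate-kernel i p = begin
      h · enum (translate i)                 ≈⟨ ×-congʳ h (enum-index _) ⟩
      h · (enum i ∙ enum i₀ ⁻¹)              ≈⟨ ×-distrib-+ (enum i) (enum i₀ ⁻¹) h ⟩
      h · enum i ∙ h · (enum i₀ ⁻¹)          ≈⟨ ∙-cong p (·-⁻¹ h (enum i₀)) ⟩
      g ∙ (h · enum i₀) ⁻¹                   ≈⟨ ∙-congˡ (⁻¹-cong p₀) ⟩
      g ∙ g ⁻¹                               ≈⟨ inverseʳ g ⟩
      ε                                      ∎
      where open SetoidReasoning setoid

  count-obstructed : ∀ (a : Fin k → Carrier) t {B} → (∀ h → length (smallCombinations a (t ∸ h)) ≤ B) →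
    ∀ j → count (λ i → anyUpTo⁺? (obstruction? a t (enum i)) j) ≤ σ G j * B
  count-obstructed a t lengths zero =
    ≤-reflexive (none⇒count≡0 (λ i → anyUpTo⁺? (obstruction? a t (enum i)) zero) (λ i → λ { (lift ()) }))
  count-obstructed a t {B} lengths (suc j) = begin
    count (λ i → anyUpTo⁺? (obstruction? a t (enum i)) (suc j))
      ≤⟨ count-⊎ _ (λ i → anyUpTo⁺? (obstruction? a t (enum i)) j) (λ i → obstruction? a t (enum i) (suc j))
                 (λ i obstructed → obstructed) ⟩
    count (λ i → anyUpTo⁺? (obstruction? a t (enum i)) j) + count (λ i → obstruction? a t (enum i) (suc j))
      ≤⟨ +-mono-≤ (count-obstructed a t lengths j) (≤-trans (count-∈ (suc j) _) (*-monoˡ-≤ _ (lengths (suc j)))) ⟩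
    σ G j * B + B * torCard G (suc j)
      ≡⟨ cong (_+_ (σ G j * B)) (*-comm B (torCard G (suc j))) ⟩
    σ G j * B + torCard G (suc j) * B
      ≡⟨ *-distribʳ-+ B (σ G j) (torCard G (suc j)) ⟨
    σ G (suc j) * B ∎
    where
    open ≤-Reasoning
    count-∈ : ∀ h xs → count (λ i → Any.any? ((h · enum i) ≈?_) xs) ≤ length xs * torCard G h
    count-∈ h xs = count-any≤ (λ i → (h · enum i) ≈?_) xs (torCard G h) (count-fibre≤torCard h)

  independentSet : ∀ t m → σ G t * ((2 * m ∸ 2 + t) C t) < n →
    ∀ k → k ≤ m → Σ (Fin k → Carrier) (Independent G t)
  independentSet t m bound zero _ = (λ ()) , λ μ w≤t relation ()
  independentSet t m bound (suc k) k<m with independentSet t m bound k (≤-trans (n≤1+n k) k<m)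
  ... | a , ind = enum (proj₁ admissible) ◃ a , independent-extend ind (proj₂ admissible)
    where
    2k≤2m∸2 : 2 * k ≤ 2 * m ∸ 2
    2k≤2m∸2 = ∸-monoˡ-≤ 2 (≤-trans (≤-reflexive (sym (*-suc 2 k))) (*-monoʳ-≤ 2 k<m))
    lengths : ∀ h → length (smallCombinations a (t ∸ h)) ≤ (2 * m ∸ 2 + t) C t
    lengths h = ≤-trans (≤-reflexive (length-smallCombinations a (t ∸ h))) (C-mono 2k≤2m∸2 (m∸n≤m t h))
    admissible : ∃ λ i → ¬ AnyUpTo⁺ (Obstruction a t (enum i)) t
    admissible = count<⇒∃¬ (λ i → anyUpTo⁺? (obstruction? a t (enum i)) t)
      (≤-<-trans (count-obstructed a t lengths t) bound)

-- The hypotheses 2 ≤ n, t ≤ n − 1 and 1 ≤ m only exclude degenerate cases and are not needed.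
proposition16 : {c ℓ : Level} (n : ℕ) (G : FiniteAbelianGroup c ℓ n) (t m : ℕ) →
    2 ≤ n → 2 ≤ t → t ≤ n ∸ 1 → 1 ≤ m →
    σ G t * (((2 * m ∸ 2) + t) C t) < n →
    Σ (Fin m → FiniteAbelianGroup.Carrier G) (λ a → Distinct G a × Independent G t a)
proposition16 n G t m _ 2≤t _ _ bound =
  let a , ind = independentSet G t m bound m ≤-refl
  in a , independent⇒distinct G 2≤t ind , ind
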